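{- Let $G$ be an ordered abelian group, $p$ a prime, $H \in \mathcal{S}_p \setminus \{\emptyset\}$, and $r \geq s \geq 1$ integers. (1) For any $a_1,\dots,a_k \in H^{[p^r]}$, the following are equivalent: (i) their images in $(H^{[p^r]}+pG)/(H+pG)$ are $\mathbb{F}_p$-linearly independent; (ii) their images in $H^{[p^r]}/(H+p^rG)$ are $(\mathbb{Z}/p^r\mathbb{Z})$-linearly independent; (iii) for all integers $m_1,\dots,m_k$ with $\min\{v_p(m_1),\dots,v_p(m_k)\} < r$, $\mathfrak{s}_{p^r}(\sum_t m_t a_t) = H$. (2) $\dim_{\mathbb{F}_p}\big((H^{[p^r]}+pG)/(H+pG)\big)$ equals the maximal cardinality of a $(\mathbb{Z}/p^r\mathbb{Z})$-linearly independent subset of $H^{[p^r]}/(H+p^rG)$. (3) If $a_1,\dots,a_k \in H^{[p^r]}$ have $(\mathbb{Z}/p^r\mathbb{Z})$-linearly independent images in $H^{[p^r]}/(H+p^rG)$, then their images in $H^{[p^s]}/(H+p^sG)$ are $(\mathbb{Z}/p^s\mathbb{Z})$-linearly independent.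
   Context: Convex subgroups of $G$ are ordered by inclusion, with $\emptyset$ below all. For $n\ge2$, $a\in G$: if $a\notin nG$, $\mathfrak{s}_n(a)$ is the largest convex subgroup $H$ with $a\notin H+nG$; else $\mathfrak{s}_n(a)=\emptyset$. $\mathcal{S}_n=\{\mathfrak{s}_n(a)\mid a\in G\}$. For convex $H$ and $m\ge 2$, $H^{[m]}=\bigcap_{H'\text{ convex}, H'\supsetneq H}(H'+mG)$ (a subgroup of $G$). $v_p$ is the $p$-adic valuation on integers (with $v_p(0)=\infty$). -}

module Defs where

open import Level using (Level; _⊔_) renaming (suc to lsuc)
open import Algebra.Bundles using (AbelianGroup)
open import Relation.Binary using (Rel; IsTotalOrder)
open import Relation.Binary.PropositionalEquality using (_≡_)
open import Relation.Unary using (Pred; _∈_; _∉_; _⊆_)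
open import Data.Nat using (ℕ; zero; suc; _^_; _<_)
open import Data.Integer using (ℤ; +_; -[1+_])
open import Data.Integer.Divisibility using (_∣_)
open import Data.Fin using (Fin; zero; suc)
open import Data.Product using (Σ; ∃; ∃₂; _×_)
open import Data.Sum using (_⊎_)
open import Relation.Nullary using (¬_)
open import Function using (_∘_)
open import Function.Definitions using (Injective)

record OrderedAbelianGroup (c ℓ₁ ℓ₂ : Level) : Set (lsuc (c ⊔ ℓ₁ ⊔ ℓ₂)) where
  field
    abelianGroup : AbelianGroup c ℓ₁
  open AbelianGroup abelianGroup public
  field
    _≤_          : Rel Carrier ℓ₂
    isTotalOrder : IsTotalOrder _≈_ _≤_
    ≤-compat     : ∀ {x y} z → x ≤ y → (x ∙ z) ≤ (y ∙ z)

-- p-adic valuation: "v_p(m) < r", i.e. v_p(m) = k for some k < r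
-- (with v_p(0) = ∞, so this never holds for m = 0).

ValuationIs : ℕ → ℤ → ℕ → Set
ValuationIs p m k = ((+ (p ^ k)) ∣ m) × ¬ ((+ (p ^ suc k)) ∣ m)

VpLessThan : ℕ → ℤ → ℕ → Set
VpLessThan p m r = ∃ λ k → k < r × ValuationIs p m k

module OAG {c ℓ₁ ℓ₂} (G : OrderedAbelianGroup c ℓ₁ ℓ₂) where
  open OrderedAbelianGroup G

  L : Level
  L = c ⊔ ℓ₁ ⊔ ℓ₂

  Subset : Set (lsuc L)
  Subset = Pred Carrier L

  _×ℕ_ : ℕ → Carrier → Carrier
  zero  ×ℕ x = ε
  suc n ×ℕ x = x ∙ (n ×ℕ x)

  _·_ : ℤ → Carrier → Carrier
  (+ n)    · x = n ×ℕ x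
  -[1+ n ] · x = (suc n ×ℕ x) ⁻¹

  sumF : ∀ {k} → (Fin k → Carrier) → Carrier
  sumF {zero}  a = ε
  sumF {suc k} a = a zero ∙ sumF (a ∘ suc)

  linComb : ∀ {k} → (Fin k → ℤ) → (Fin k → Carrier) → Carrier
  linComb m a = sumF (λ t → m t · a t)

  record IsConvexSubgroup (H : Subset) : Set L where
    field
      resp   : ∀ {x y} → x ≈ y → x ∈ H → y ∈ H
      ε∈     : ε ∈ H
      ∙∈     : ∀ {x y} → x ∈ H → y ∈ H → (x ∙ y) ∈ H
      ⁻¹∈    : ∀ {x} → x ∈ H → (x ⁻¹) ∈ H
      convex : ∀ {x y z} → x ≤ y → y ≤ z → x ∈ H → z ∈ H → y ∈ H

  _*G : ℕ → Pred Carrier (c ⊔ ℓ₁)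
  (n *G) x = ∃ λ y → x ≈ (n ×ℕ y)

  _⊕_G : ∀ {ℓ} → Pred Carrier ℓ → ℕ → Pred Carrier (c ⊔ ℓ₁ ⊔ ℓ)
  (H ⊕ n G) x = ∃₂ λ h y → h ∈ H × x ≈ (h ∙ (n ×ℕ y))

  IsEmpty : ∀ {ℓ} → Pred Carrier ℓ → Set (c ⊔ ℓ)
  IsEmpty S = ∀ x → x ∉ S

  𝔰[_]_≐_ : ℕ → Carrier → Subset → Set (lsuc L)
  𝔰[ n ] a ≐ S =
      ((a ∈ n *G) × IsEmpty S)
    ⊎ ((a ∉ n *G) × IsConvexSubgroup S × (a ∉ S ⊕ n G)
       × (∀ (H′ : Subset) → IsConvexSubgroup H′ → a ∉ H′ ⊕ n G → H′ ⊆ S))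

  _∈𝒮[_] : Subset → ℕ → Set (lsuc L)
  H ∈𝒮[ n ] = ∃ λ a → 𝔰[ n ] a ≐ H

  _^[_] : Subset → ℕ → Pred Carrier (lsuc L)
  (H ^[ m ]) x = ∀ (H′ : Subset) → IsConvexSubgroup H′ → H ⊆ H′ → ¬ (H′ ⊆ H)
                 → x ∈ H′ ⊕ m G

  -- The images of a_1..a_k in a quotient (subgroup)/N, viewed as a
  -- (ℤ/nℤ)-module, are linearly independent:  Σ m_t a_t ∈ N  ⇒  n ∣ m_t ∀t.
  LinIndepMod : ∀ {ℓ k} → ℕ → Pred Carrier ℓ → (Fin k → Carrier) → Set ℓ
  LinIndepMod {k = k} n N a =
    ∀ (m : Fin k → ℤ) → linComb m a ∈ N → ∀ t → (+ n) ∣ m t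

  FamIndepMod : ∀ {ℓ ℓI} {I : Set ℓI} → ℕ → Pred Carrier ℓ → (I → Carrier) → Set (ℓ ⊔ ℓI)
  FamIndepMod {I = I} n N f =
    ∀ k (ι : Fin k → I) → Injective _≡_ _≡_ ι → LinIndepMod n N (f ∘ ι)

{-# OPTIONS --safe #-}
module Submission where

open import Defs
open import Level using (Level; _⊔_)
open import Data.Nat using (ℕ; zero; suc; _^_; _≤_; z≤n; s≤s; NonZero)
import Data.Nat as ℕ
import Data.Nat.Properties as ℕ
import Data.Nat.Divisibility as ℕ
open import Data.Nat.Primality using (Prime; prime⇒nonZero)
open import Data.Integer using (ℤ; +_; -[1+_]; ∣_∣)
import Data.Integer as ℤ
import Data.Integer.Properties as ℤ
open import Data.Integer.Divisibility using (_∣_; *-monoˡ-∣; *-cancelʳ-∣)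
import Data.Integer.Divisibility.Signed as Signed
open import Data.Fin using (Fin; zero; suc)
open import Data.Product using (Σ; ∃; _×_; _,_; proj₁; proj₂)
open import Data.Sum using (inj₁; inj₂; _⊎_)
import Data.Sum as Sum
open import Data.Empty using (⊥-elim)
open import Relation.Nullary using (¬_)
open import Relation.Nullary.Decidable using (decidable-stable)
open import Relation.Unary using (Pred; _∈_; _∉_; _⊆_)
open import Relation.Binary using (IsTotalOrder)
import Relation.Binary.PropositionalEquality as P
open P using (_≡_)
open import Function using (_∘_; id)
open import Function.Bundles using (_⇔_; mk⇔)

-- A convex subgroup H is isolated (N z ∈ H with N ≠ 0 forces z ∈ H), so
-- pʳ c ∈ H + pʳ⁺¹G iff c ∈ H + pG. Peeling off one factor p at a time turns
-- independence modulo H + pG into independence modulo H + pʳG; multiplying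
-- the coefficients by pʳ⁻¹ turns it back. A combination with some vₚ(mₜ) < r
-- then avoids H + pʳG. If it also avoids H′ + pʳG for a convex H′, then H′
-- cannot properly contain H, because the aₜ lie in H′ + pʳG; as convex
-- subgroups form a chain, the witness a₀ of H ∈ 𝒮ₚ then avoids H′ + pG, and
-- maximality gives H′ ⊆ H. Conversely, if p ∤ mₜ, the coefficients pʳ⁻¹m have
-- valuation r − 1 but their combination lies in H + pʳG, so 𝔰 ≠ H. In (2), a
-- family in H^[pʳ] + pG keeps its independence modulo H + pG when its members
-- are replaced by their components in H^[pʳ].

^-monoʳ-∣ : ∀ p {m n} → m ≤ n → p ^ m ℕ.∣ p ^ n
^-monoʳ-∣ p {m} {n} m≤n = ℕ.divides (p ^ (n ℕ.∸ m)) (begin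
  p ^ n                   ≡⟨ P.cong (p ^_) (ℕ.m∸n+n≡m m≤n) ⟨
  p ^ (n ℕ.∸ m ℕ.+ m)     ≡⟨ ℕ.^-distribˡ-+-* p (n ℕ.∸ m) m ⟩
  p ^ (n ℕ.∸ m) ℕ.* p ^ m ∎)
  where open P.≡-Reasoning

vₚ<r⇒pʳ∤ : ∀ {p r} z → VpLessThan p z r → ¬ (+ (p ^ r) ∣ z)
vₚ<r⇒pʳ∤ {p} _ (_ , k<r , _ , p¹⁺ᵏ∤z) pʳ∣z = p¹⁺ᵏ∤z (ℕ.∣-trans (^-monoʳ-∣ p k<r) pʳ∣z)

module _ (p r : ℕ) (n : ℤ) where

  p∣n⇒p¹⁺ʳ∣n*pʳ : + p ∣ n → + (p ^ suc r) ∣ n ℤ.* + (p ^ r)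
  p∣n⇒p¹⁺ʳ∣n*pʳ p∣n =
    P.subst (_∣ n ℤ.* + (p ^ r)) (P.sym (ℤ.pos-* p (p ^ r))) (*-monoˡ-∣ (+ (p ^ r)) {+ p} {n} p∣n)

  p¹⁺ʳ∣n*pʳ⇒p∣n : .{{_ : NonZero p}} → + (p ^ suc r) ∣ n ℤ.* + (p ^ r) → + p ∣ n
  p¹⁺ʳ∣n*pʳ⇒p∣n p¹⁺ʳ∣n*pʳ = *-cancelʳ-∣ (+ (p ^ r)) {+ p} {n} {{ℕ.m^n≢0 p r}}
    (P.subst (_∣ n ℤ.* + (p ^ r)) (ℤ.pos-* p (p ^ r)) p¹⁺ʳ∣n*pʳ)

  valuation[n*pʳ]≡r : .{{_ : NonZero p}} → ¬ (+ p ∣ n) → ValuationIs p (n ℤ.* + (p ^ r)) r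
  valuation[n*pʳ]≡r p∤n = Signed.∣⇒∣ᵤ (Signed.∣n⇒∣m*n n Signed.∣-refl) , p∤n ∘ p¹⁺ʳ∣n*pʳ⇒p∣n

module OrderedAbelianGroupProperties {c ℓ₁ ℓ₂} (G : OrderedAbelianGroup c ℓ₁ ℓ₂) where
  open OrderedAbelianGroup G renaming (_≤_ to infix 4 _≼_)
  open OAG G
  open import Algebra.Properties.AbelianGroup abelianGroup
  open import Algebra.Properties.CommutativeSemigroup commutativeSemigroup using (interchange)
  open import Algebra.Properties.CommutativeMonoid.Mult commutativeMonoid
    using (×-congʳ; ×-congˡ; ×-assocˡ; ×-distrib-+) renaming (_×_ to _×ᴹ_)
  open import Algebra.Properties.CommutativeMonoid.Sum commutativeMonoid
    using (sum; sum-cong-≋; ∑-distrib-+)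
  open import Relation.Binary.Reasoning.Setoid setoid
  module ≼ = IsTotalOrder isTotalOrder

  ×ℕ≡×ᴹ : ∀ n x → n ×ℕ x ≡ n ×ᴹ x
  ×ℕ≡×ᴹ zero    x = P.refl
  ×ℕ≡×ᴹ (suc n) x = P.cong (x ∙_) (×ℕ≡×ᴹ n x)

  ×ℕ-congʳ : ∀ n {x y} → x ≈ y → n ×ℕ x ≈ n ×ℕ y
  ×ℕ-congʳ n {x} {y} x≈y rewrite ×ℕ≡×ᴹ n x | ×ℕ≡×ᴹ n y = ×-congʳ n x≈y

  ×ℕ-distrib-∙ : ∀ n x y → n ×ℕ (x ∙ y) ≈ n ×ℕ x ∙ n ×ℕ y
  ×ℕ-distrib-∙ n x y rewrite ×ℕ≡×ᴹ n (x ∙ y) | ×ℕ≡×ᴹ n x | ×ℕ≡×ᴹ n y = ×-distrib-+ x y n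

  ×ℕ-homo-* : ∀ m n x → (m ℕ.* n) ×ℕ x ≈ n ×ℕ (m ×ℕ x)
  ×ℕ-homo-* m n x rewrite ×ℕ≡×ᴹ (m ℕ.* n) x | ×ℕ≡×ᴹ m x | ×ℕ≡×ᴹ n (m ×ᴹ x) =
    trans (×-congˡ (ℕ.*-comm m n)) (sym (×-assocˡ x n m))

  ×ℕ-ε : ∀ n → n ×ℕ ε ≈ ε
  ×ℕ-ε zero    = refl
  ×ℕ-ε (suc n) = trans (identityˡ _) (×ℕ-ε n)

  ×ℕ-⁻¹ : ∀ n x → n ×ℕ (x ⁻¹) ≈ (n ×ℕ x) ⁻¹
  ×ℕ-⁻¹ zero    x = sym ε⁻¹≈ε
  ×ℕ-⁻¹ (suc n) x = trans (∙-congˡ (×ℕ-⁻¹ n x)) (⁻¹-∙-comm x (n ×ℕ x))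

  ·-congʳ : ∀ i {x y} → x ≈ y → i · x ≈ i · y
  ·-congʳ (+ n)    = ×ℕ-congʳ n
  ·-congʳ -[1+ n ] = ⁻¹-cong ∘ ×ℕ-congʳ (suc n)

  ·-distrib-∙ : ∀ i x y → i · (x ∙ y) ≈ i · x ∙ i · y
  ·-distrib-∙ (+ n)    x y = ×ℕ-distrib-∙ n x y
  ·-distrib-∙ -[1+ n ] x y =
    trans (⁻¹-cong (×ℕ-distrib-∙ (suc n) x y)) (sym (⁻¹-∙-comm _ _))

  -+·≈×ℕ⁻¹ : ∀ n x → (ℤ.- (+ n)) · x ≈ (n ×ℕ x) ⁻¹
  -+·≈×ℕ⁻¹ zero    x = sym ε⁻¹≈ε
  -+·≈×ℕ⁻¹ (suc n) x = refl

  ·-*ʳ : ∀ i N x → (i ℤ.* + N) · x ≈ N ×ℕ (i · x)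
  ·-*ʳ (+ n) N x = begin
    (+ n ℤ.* + N) · x ≡⟨ P.cong (_· x) (ℤ.pos-* n N) ⟨
    (n ℕ.* N) ×ℕ x    ≈⟨ ×ℕ-homo-* n N x ⟩
    N ×ℕ (n ×ℕ x)     ∎
  ·-*ʳ -[1+ n ] N x = begin
    (-[1+ n ] ℤ.* + N) · x          ≡⟨ P.cong (_· x) (ℤ.neg-distribˡ-* (+ suc n) (+ N)) ⟨
    (ℤ.- (+ suc n ℤ.* + N)) · x     ≡⟨ P.cong (λ i → (ℤ.- i) · x) (ℤ.pos-* (suc n) N) ⟨
    (ℤ.- (+ (suc n ℕ.* N))) · x     ≈⟨ -+·≈×ℕ⁻¹ (suc n ℕ.* N) x ⟩
    ((suc n ℕ.* N) ×ℕ x) ⁻¹         ≈⟨ ⁻¹-cong (×ℕ-homo-* (suc n) N x) ⟩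
    (N ×ℕ (suc n ×ℕ x)) ⁻¹          ≈⟨ ×ℕ-⁻¹ N _ ⟨
    N ×ℕ ((suc n ×ℕ x) ⁻¹)          ∎

  sumF≡sum : ∀ {k} (a : Fin k → Carrier) → sumF a ≡ sum a
  sumF≡sum {zero}  a = P.refl
  sumF≡sum {suc k} a = P.cong (a zero ∙_) (sumF≡sum (a ∘ suc))

  sumF-cong : ∀ {k} {a b : Fin k → Carrier} → (∀ t → a t ≈ b t) → sumF a ≈ sumF b
  sumF-cong {a = a} {b} a≈b rewrite sumF≡sum a | sumF≡sum b = sum-cong-≋ a≈b

  sumF-distrib-∙ : ∀ {k} (a b : Fin k → Carrier) → sumF (λ t → a t ∙ b t) ≈ sumF a ∙ sumF b
  sumF-distrib-∙ a b rewrite sumF≡sum (λ t → a t ∙ b t) | sumF≡sum a | sumF≡sum b =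
    ∑-distrib-+ a b

  ×ℕ-sumF : ∀ N {k} (a : Fin k → Carrier) → N ×ℕ sumF a ≈ sumF (λ t → N ×ℕ a t)
  ×ℕ-sumF N {zero}  a = ×ℕ-ε N
  ×ℕ-sumF N {suc k} a = trans (×ℕ-distrib-∙ N _ _) (∙-congˡ (×ℕ-sumF N (a ∘ suc)))

  linComb-congˡ : ∀ {k} {m n : Fin k → ℤ} (a : Fin k → Carrier) →
                  (∀ t → m t ≡ n t) → linComb m a ≈ linComb n a
  linComb-congˡ a m≡n = sumF-cong (λ t → reflexive (P.cong (_· a t) (m≡n t)))

  linComb-congʳ : ∀ {k} (m : Fin k → ℤ) {a b : Fin k → Carrier} →
                  (∀ t → a t ≈ b t) → linComb m a ≈ linComb m b
  linComb-congʳ m a≈b = sumF-cong (λ t → ·-congʳ (m t) (a≈b t))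

  linComb-distrib-∙ : ∀ {k} (m : Fin k → ℤ) (a b : Fin k → Carrier) →
                      linComb m (λ t → a t ∙ b t) ≈ linComb m a ∙ linComb m b
  linComb-distrib-∙ m a b =
    trans (sumF-cong (λ t → ·-distrib-∙ (m t) (a t) (b t)))
          (sumF-distrib-∙ (λ t → m t · a t) (λ t → m t · b t))

  linComb-*ʳ : ∀ N {k} (m : Fin k → ℤ) (a : Fin k → Carrier) →
               linComb (λ t → m t ℤ.* + N) a ≈ N ×ℕ linComb m a
  linComb-*ʳ N m a =
    trans (sumF-cong (λ t → ·-*ʳ (m t) N (a t))) (sym (×ℕ-sumF N (λ t → m t · a t)))

  record IsSubgroup {ℓ} (S : Pred Carrier ℓ) : Set (c ⊔ ℓ₁ ⊔ ℓ) where
    field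
      resp : ∀ {x y} → x ≈ y → x ∈ S → y ∈ S
      ε∈   : ε ∈ S
      ∙∈   : ∀ {x y} → x ∈ S → y ∈ S → (x ∙ y) ∈ S
      ⁻¹∈  : ∀ {x} → x ∈ S → (x ⁻¹) ∈ S

    ×ℕ∈ : ∀ n {x} → x ∈ S → n ×ℕ x ∈ S
    ×ℕ∈ zero    _   = ε∈
    ×ℕ∈ (suc n) x∈S = ∙∈ x∈S (×ℕ∈ n x∈S)

    ·∈ : ∀ i {x} → x ∈ S → i · x ∈ S
    ·∈ (+ n)    = ×ℕ∈ n
    ·∈ -[1+ n ] = ⁻¹∈ ∘ ×ℕ∈ (suc n)

    sumF∈ : ∀ {k} (a : Fin k → Carrier) → (∀ t → a t ∈ S) → sumF a ∈ S
    sumF∈ {zero}  a _   = ε∈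
    sumF∈ {suc k} a a∈S = ∙∈ (a∈S zero) (sumF∈ (a ∘ suc) (a∈S ∘ suc))

    linComb∈ : ∀ {k} (m : Fin k → ℤ) (a : Fin k → Carrier) → (∀ t → a t ∈ S) → linComb m a ∈ S
    linComb∈ m a a∈S = sumF∈ _ (λ t → ·∈ (m t) (a∈S t))

  convex⇒subgroup : ∀ {K : Subset} → IsConvexSubgroup K → IsSubgroup K
  convex⇒subgroup K-convex = record { resp = resp ; ε∈ = ε∈ ; ∙∈ = ∙∈ ; ⁻¹∈ = ⁻¹∈ }
    where open IsConvexSubgroup K-convex

  LinIndepMod-resp-∙ : ∀ {ℓ k n} {N : Pred Carrier ℓ} {f g : Fin k → Carrier} (d : Fin k → Carrier) →
                       IsSubgroup N → (∀ t → f t ≈ g t ∙ d t) → (∀ t → d t ∈ N) →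
                       LinIndepMod n N f → LinIndepMod n N g
  LinIndepMod-resp-∙ {N = N} {f} {g} d N-subgroup f≈g∙d d∈N f-indep m gm∈N = f-indep m fm∈N
    where
    open IsSubgroup N-subgroup
    fm∈N : linComb m f ∈ N
    fm∈N = resp (sym (trans (linComb-congʳ m f≈g∙d) (linComb-distrib-∙ m g d)))
                (∙∈ gm∈N (linComb∈ m d d∈N))

  ⊆-⊕ : ∀ {ℓ} {S : Pred Carrier ℓ} n → S ⊆ S ⊕ n G
  ⊆-⊕ n {x} x∈S = x , ε , x∈S , sym (trans (∙-congˡ (×ℕ-ε n)) (identityʳ x))

  *G⊆⊕ : ∀ {ℓ} {K : Pred Carrier ℓ} → ε ∈ K → ∀ n → n *G ⊆ K ⊕ n G
  *G⊆⊕ ε∈K n (y , x≈ny) = ε , y , ε∈K , trans x≈ny (sym (identityˡ _))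

  ⊕-isSubgroup : ∀ {ℓ} {K : Pred Carrier ℓ} → IsSubgroup K → ∀ n → IsSubgroup (K ⊕ n G)
  ⊕-isSubgroup K-subgroup n = record
    { resp = λ { x≈y (h , z , h∈K , x≈) → h , z , h∈K , trans (sym x≈y) x≈ }
    ; ε∈   = ⊆-⊕ n ε∈
    ; ∙∈   = λ { (h , y , h∈K , x≈) (h′ , y′ , h′∈K , x′≈) →
               h ∙ h′ , y ∙ y′ , ∙∈ h∈K h′∈K ,
               trans (∙-cong x≈ x′≈)
                     (trans (interchange _ _ _ _) (∙-congˡ (sym (×ℕ-distrib-∙ n y y′)))) }
    ; ⁻¹∈  = λ { (h , y , h∈K , x≈) →
               h ⁻¹ , y ⁻¹ , ⁻¹∈ h∈K ,
               trans (⁻¹-cong x≈) (trans (sym (⁻¹-∙-comm _ _)) (∙-congˡ (sym (×ℕ-⁻¹ n y)))) }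
    }
    where open IsSubgroup K-subgroup

  ⊕-anti : ∀ {ℓ} {K : Pred Carrier ℓ} M N → K ⊕ (M ℕ.* N) G ⊆ K ⊕ N G
  ⊕-anti M N (h , y , h∈K , x≈) = h , M ×ℕ y , h∈K , trans x≈ (∙-congˡ (×ℕ-homo-* M N y))

  ⊕-scale : ∀ {ℓ} {K : Pred Carrier ℓ} → IsSubgroup K → ∀ M N {x} →
            x ∈ K ⊕ M G → N ×ℕ x ∈ K ⊕ (M ℕ.* N) G
  ⊕-scale K-subgroup M N (h , y , h∈K , x≈) = N ×ℕ h , y , ×ℕ∈ N h∈K , (begin
    N ×ℕ _                      ≈⟨ ×ℕ-congʳ N x≈ ⟩
    N ×ℕ (h ∙ M ×ℕ y)           ≈⟨ ×ℕ-distrib-∙ N h (M ×ℕ y) ⟩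
    N ×ℕ h ∙ N ×ℕ (M ×ℕ y)      ≈⟨ ∙-congˡ (×ℕ-homo-* M N y) ⟨
    N ×ℕ h ∙ (M ℕ.* N) ×ℕ y     ∎)
    where open IsSubgroup K-subgroup

  ≼-resp₂ : ∀ {x x′ y y′} → x ≈ x′ → y ≈ y′ → x ≼ y → x′ ≼ y′
  ≼-resp₂ x≈x′ y≈y′ = ≼.≲-respʳ-≈ y≈y′ ∘ ≼.≲-respˡ-≈ x≈x′

  ⁻¹-antimono : ∀ {x y} → x ≼ y → y ⁻¹ ≼ x ⁻¹
  ⁻¹-antimono {x} {y} x≼y = ≼-resp₂ x∙[x⁻¹∙y⁻¹]≈y⁻¹ y∙[x⁻¹∙y⁻¹]≈x⁻¹ (≤-compat (x ⁻¹ ∙ y ⁻¹) x≼y)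
    where
    x∙[x⁻¹∙y⁻¹]≈y⁻¹ : x ∙ (x ⁻¹ ∙ y ⁻¹) ≈ y ⁻¹
    x∙[x⁻¹∙y⁻¹]≈y⁻¹ = \\-leftDividesˡ x (y ⁻¹)
    y∙[x⁻¹∙y⁻¹]≈x⁻¹ : y ∙ (x ⁻¹ ∙ y ⁻¹) ≈ x ⁻¹
    y∙[x⁻¹∙y⁻¹]≈x⁻¹ = trans (∙-congˡ (comm _ _)) (\\-leftDividesˡ y (x ⁻¹))

  ≼ε⇒ε≼⁻¹ : ∀ {x} → x ≼ ε → ε ≼ x ⁻¹
  ≼ε⇒ε≼⁻¹ x≼ε = ≼.≲-respˡ-≈ ε⁻¹≈ε (⁻¹-antimono x≼ε)

  ×ℕ-nonneg : ∀ n {x} → ε ≼ x → ε ≼ n ×ℕ x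
  ×ℕ-nonneg zero    ε≼x = ≼.refl
  ×ℕ-nonneg (suc n) {x} ε≼x =
    ≼.trans (≼.≲-respʳ-≈ (sym (identityˡ _)) (×ℕ-nonneg n ε≼x)) (≤-compat (n ×ℕ x) ε≼x)

  ≼-suc×ℕ : ∀ n {x} → ε ≼ x → x ≼ suc n ×ℕ x
  ≼-suc×ℕ n {x} ε≼x = ≼-resp₂ (identityˡ x) (comm _ _) (≤-compat x (×ℕ-nonneg n ε≼x))

  ×ℕ∈⇒∈ : ∀ {K : Subset} → IsConvexSubgroup K → ∀ N .{{_ : NonZero N}} {z} → N ×ℕ z ∈ K → z ∈ K
  ×ℕ∈⇒∈ {K} K-convex (suc n) {z} Nz∈K = Sum.[ nonneg Nz∈K , nonpos ]′ (≼.total ε z)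
    where
    open IsConvexSubgroup K-convex
    nonneg : ∀ {x} → suc n ×ℕ x ∈ K → ε ≼ x → x ∈ K
    nonneg Nx∈K ε≼x = convex ε≼x (≼-suc×ℕ n ε≼x) ε∈ Nx∈K
    nonpos : z ≼ ε → z ∈ K
    nonpos z≼ε = resp (⁻¹-involutive z)
      (⁻¹∈ (nonneg (resp (sym (×ℕ-⁻¹ (suc n) z)) (⁻¹∈ Nz∈K)) (≼ε⇒ε≼⁻¹ z≼ε)))

  ⊕-unscale : ∀ {K : Subset} → IsConvexSubgroup K → ∀ M N .{{_ : NonZero N}} {x} →
              N ×ℕ x ∈ K ⊕ (M ℕ.* N) G → x ∈ K ⊕ M G
  ⊕-unscale K-convex M N {x} (h , y , h∈K , Nx≈) =
    x ∙ w ⁻¹ , y , ×ℕ∈⇒∈ K-convex N (resp (sym N[x∙w⁻¹]≈h) h∈K) , sym (//-rightDividesˡ w x)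
    where
    open IsConvexSubgroup K-convex
    w = M ×ℕ y
    N[x∙w⁻¹]≈h : N ×ℕ (x ∙ w ⁻¹) ≈ h
    N[x∙w⁻¹]≈h = begin
      N ×ℕ (x ∙ w ⁻¹)                   ≈⟨ ×ℕ-distrib-∙ N x (w ⁻¹) ⟩
      N ×ℕ x ∙ N ×ℕ (w ⁻¹)              ≈⟨ ∙-cong Nx≈ (×ℕ-⁻¹ N w) ⟩
      h ∙ (M ℕ.* N) ×ℕ y ∙ (N ×ℕ w) ⁻¹  ≈⟨ ∙-congʳ (∙-congˡ (×ℕ-homo-* M N y)) ⟩
      h ∙ N ×ℕ w ∙ (N ×ℕ w) ⁻¹          ≈⟨ //-rightDividesʳ (N ×ℕ w) h ⟩
      h                                 ∎

  abs : Carrier → Carrier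
  abs x with ≼.total ε x
  ... | inj₁ _ = x
  ... | inj₂ _ = x ⁻¹

  abs-nonneg : ∀ x → ε ≼ abs x
  abs-nonneg x with ≼.total ε x
  ... | inj₁ ε≼x = ε≼x
  ... | inj₂ x≼ε = ≼ε⇒ε≼⁻¹ x≼ε

  abs∈ : ∀ {ℓ} {K : Pred Carrier ℓ} → IsSubgroup K → ∀ {x} → x ∈ K → abs x ∈ K
  abs∈ K-subgroup {x} x∈K with ≼.total ε x
  ... | inj₁ _ = x∈K
  ... | inj₂ _ = IsSubgroup.⁻¹∈ K-subgroup x∈K

  abs∈⇒∈ : ∀ {ℓ} {K : Pred Carrier ℓ} → IsSubgroup K → ∀ {x} → abs x ∈ K → x ∈ K
  abs∈⇒∈ K-subgroup {x} ∣x∣∈K with ≼.total ε x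
  ... | inj₁ _ = ∣x∣∈K
  ... | inj₂ _ = resp (⁻¹-involutive x) (⁻¹∈ ∣x∣∈K)
    where open IsSubgroup K-subgroup

  abs≼⇒∈ : ∀ {K : Subset} → IsConvexSubgroup K → ∀ {x y} → abs x ≼ abs y → y ∈ K → x ∈ K
  abs≼⇒∈ K-convex {x} ∣x∣≼∣y∣ y∈K = abs∈⇒∈ K-subgroup
    (convex (abs-nonneg x) ∣x∣≼∣y∣ ε∈ (abs∈ K-subgroup y∈K))
    where
    open IsConvexSubgroup K-convex
    K-subgroup = convex⇒subgroup K-convex

  comparable : ∀ {A B : Subset} → IsConvexSubgroup A → IsConvexSubgroup B →
               ∀ {x y} → x ∈ A → y ∈ B → x ∈ B ⊎ y ∈ A
  comparable A-convex B-convex {x} {y} x∈A y∈B =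
    Sum.map (λ ∣x∣≼∣y∣ → abs≼⇒∈ B-convex ∣x∣≼∣y∣ y∈B) (λ ∣y∣≼∣x∣ → abs≼⇒∈ A-convex ∣y∣≼∣x∣ x∈A)
            (≼.total (abs x) (abs y))

  ∉⊕∧∈⊕⇒⊂ : ∀ {A B : Subset} → IsConvexSubgroup A → IsConvexSubgroup B → ∀ n {x} →
            x ∉ A ⊕ n G → x ∈ B ⊕ n G → A ⊆ B × ¬ (B ⊆ A)
  ∉⊕∧∈⊕⇒⊂ {A} A-convex B-convex n x∉A⊕nG (y , z , y∈B , x≈) =
    (λ h∈A → Sum.[ id , ⊥-elim ∘ y∉A ]′ (comparable A-convex B-convex h∈A y∈B)) ,
    (λ B⊆A → y∉A (B⊆A y∈B))
    where
    y∉A : y ∉ A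
    y∉A y∈A = x∉A⊕nG (y , z , y∈A , x≈)

  𝔰≐-intro : ∀ {S : Subset} n {x} → IsConvexSubgroup S → x ∉ S ⊕ n G →
             (∀ (H′ : Subset) → IsConvexSubgroup H′ → x ∉ H′ ⊕ n G → H′ ⊆ S) → 𝔰[ n ] x ≐ S
  𝔰≐-intro n S-convex x∉S⊕nG largest =
    inj₂ (x∉S⊕nG ∘ *G⊆⊕ (IsConvexSubgroup.ε∈ S-convex) n , S-convex , x∉S⊕nG , largest)

  𝔰≐⇒∉⊕ : ∀ {S : Subset} n {x} → ¬ IsEmpty S → 𝔰[ n ] x ≐ S → x ∉ S ⊕ n G
  𝔰≐⇒∉⊕ _ S≢∅ (inj₁ (_ , S-empty))              = ⊥-elim (S≢∅ S-empty)
  𝔰≐⇒∉⊕ _ S≢∅ (inj₂ (_ , _ , x∉S⊕nG , _)) = x∉S⊕nG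

  module Independence (p : ℕ) .{{_ : NonZero p}} {H : Subset} (H-convex : IsConvexSubgroup H) where
    H-subgroup : IsSubgroup H
    H-subgroup = convex⇒subgroup H-convex

    linComb-*pʳ∈ : ∀ r {k} (m : Fin k → ℤ) (a : Fin k → Carrier) → linComb m a ∈ H ⊕ p G →
                   linComb (λ t → m t ℤ.* + (p ^ r)) a ∈ H ⊕ p ^ suc r G
    linComb-*pʳ∈ r m a ma∈ = IsSubgroup.resp (⊕-isSubgroup H-subgroup (p ^ suc r))
      (sym (linComb-*ʳ (p ^ r) m a)) (⊕-scale H-subgroup p (p ^ r) ma∈)

    indep⇒indep-pow : ∀ r {k} {a : Fin k → Carrier} →
                      LinIndepMod p (H ⊕ p G) a → LinIndepMod (p ^ r) (H ⊕ p ^ r G) a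
    indep⇒indep-pow zero    _ _ _ _ = ℕ.1∣ _
    indep⇒indep-pow (suc r) {a = a} a-indep m ma∈ t =
      P.subst (+ (p ^ suc r) ∣_) (P.sym (m≡n*pʳ t)) (p∣n⇒p¹⁺ʳ∣n*pʳ p r (n t) (a-indep n na∈ t))
      where
      pʳ∣m : ∀ t → + (p ^ r) ∣ m t
      pʳ∣m = indep⇒indep-pow r a-indep m (⊕-anti p (p ^ r) ma∈)
      n : _ → ℤ
      n t = Signed._∣_.quotient (Signed.∣ᵤ⇒∣ {+ (p ^ r)} {m t} (pʳ∣m t))
      m≡n*pʳ : ∀ t → m t ≡ n t ℤ.* + (p ^ r)
      m≡n*pʳ t = Signed._∣_.equality (Signed.∣ᵤ⇒∣ {+ (p ^ r)} {m t} (pʳ∣m t))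
      na∈ : linComb n a ∈ H ⊕ p G
      na∈ = ⊕-unscale H-convex p (p ^ r) {{ℕ.m^n≢0 p r}}
        (IsSubgroup.resp (⊕-isSubgroup H-subgroup (p ^ suc r))
          (trans (linComb-congˡ a m≡n*pʳ) (linComb-*ʳ (p ^ r) n a)) ma∈)

    indep-pow⇒indep : ∀ r {k} {a : Fin k → Carrier} →
                      LinIndepMod (p ^ suc r) (H ⊕ p ^ suc r G) a → LinIndepMod p (H ⊕ p G) a
    indep-pow⇒indep r {a = a} a-indep m ma∈ t =
      p¹⁺ʳ∣n*pʳ⇒p∣n p r (m t) (a-indep (λ t → m t ℤ.* + (p ^ r)) (linComb-*pʳ∈ r m a ma∈) t)

    𝔰≐⇒indep : ¬ IsEmpty H → ∀ r {k} {a : Fin k → Carrier} →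
               (∀ (m : Fin k → ℤ) → (∃ λ t → VpLessThan p (m t) (suc r)) →
                 𝔰[ p ^ suc r ] linComb m a ≐ H) →
               LinIndepMod p (H ⊕ p G) a
    𝔰≐⇒indep H≢∅ r {a = a} 𝔰≐H m ma∈ t = decidable-stable (p ℕ.∣? ∣ m t ∣) λ p∤mₜ →
      𝔰≐⇒∉⊕ (p ^ suc r) H≢∅
        (𝔰≐H (λ t → m t ℤ.* + (p ^ r)) (t , r , ℕ.n<1+n r , valuation[n*pʳ]≡r p r (m t) p∤mₜ))
        (linComb-*pʳ∈ r m a ma∈)

    indep-pow⇒𝔰≐ : ∀ {a₀} → a₀ ∉ H ⊕ p G →
                   (∀ (H′ : Subset) → IsConvexSubgroup H′ → a₀ ∉ H′ ⊕ p G → H′ ⊆ H) →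
                   ∀ r {k} {a : Fin k → Carrier} → (∀ t → a t ∈ H ^[ p ^ r ]) →
                   LinIndepMod (p ^ r) (H ⊕ p ^ r G) a →
                   ∀ (m : Fin k → ℤ) → (∃ λ t → VpLessThan p (m t) r) → 𝔰[ p ^ r ] linComb m a ≐ H
    indep-pow⇒𝔰≐ a₀∉H⊕pG H-largest r {a = a} a∈H^ a-indep m (t , vₚ<r) =
      𝔰≐-intro (p ^ r) H-convex ma∉H⊕pʳG largest
      where
      ma∉H⊕pʳG : linComb m a ∉ H ⊕ p ^ r G
      ma∉H⊕pʳG ma∈ = vₚ<r⇒pʳ∤ (m t) vₚ<r (a-indep m ma∈ t)
      largest : ∀ (H′ : Subset) → IsConvexSubgroup H′ → linComb m a ∉ H′ ⊕ p ^ r G → H′ ⊆ H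
      largest H′ H′-convex ma∉H′⊕pʳG = H-largest H′ H′-convex λ a₀∈H′⊕pG →
        let H⊆H′ , H′⊈H = ∉⊕∧∈⊕⇒⊂ H-convex H′-convex p a₀∉H⊕pG a₀∈H′⊕pG
        in ma∉H′⊕pʳG (IsSubgroup.linComb∈ (⊕-isSubgroup (convex⇒subgroup H′-convex) (p ^ r)) m a
                        (λ t → a∈H^ t H′ H′-convex H⊆H′ H′⊈H))

    famIndep⇒famIndep-pow : ∀ r {ℓ ℓI} {S : Pred Carrier ℓ} {I : Set ℓI} →
      (Σ (I → Carrier) λ f → (∀ i → f i ∈ S ⊕ p G) × FamIndepMod p (H ⊕ p G) f) →
      (Σ (I → Carrier) λ g → (∀ i → g i ∈ S) × FamIndepMod (p ^ r) (H ⊕ p ^ r G) g)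
    famIndep⇒famIndep-pow r (f , f∈S⊕pG , f-indep) =
      g , g∈S , λ k ι ι-injective → indep⇒indep-pow r
        (LinIndepMod-resp-∙ (λ t → p ×ℕ y (ι t)) (⊕-isSubgroup H-subgroup p) (f≈g∙py ∘ ι)
          (λ t → *G⊆⊕ (IsConvexSubgroup.ε∈ H-convex) p (y (ι t) , refl)) (f-indep k ι ι-injective))
      where
      g = λ i → proj₁ (f∈S⊕pG i)
      y = λ i → proj₁ (proj₂ (f∈S⊕pG i))
      g∈S = λ i → proj₁ (proj₂ (proj₂ (f∈S⊕pG i)))
      f≈g∙py = λ i → proj₂ (proj₂ (proj₂ (f∈S⊕pG i)))

    famIndep-pow⇒famIndep : ∀ r {ℓ ℓI} {S : Pred Carrier ℓ} {I : Set ℓI} →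
      (Σ (I → Carrier) λ f → (∀ i → f i ∈ S) × FamIndepMod (p ^ suc r) (H ⊕ p ^ suc r G) f) →
      (Σ (I → Carrier) λ f → (∀ i → f i ∈ S ⊕ p G) × FamIndepMod p (H ⊕ p G) f)
    famIndep-pow⇒famIndep r (f , f∈S , f-indep) =
      f , ⊆-⊕ p ∘ f∈S , λ k ι ι-injective → indep-pow⇒indep r (f-indep k ι ι-injective)

lemma2p15 : ∀ {c ℓ₁ ℓ₂ : Level} (G : OrderedAbelianGroup c ℓ₁ ℓ₂) →
    let open OrderedAbelianGroup G using (Carrier) in
    let open OAG G in
    (p : ℕ) → Prime p →
    (H : Subset) → H ∈𝒮[ p ] → ¬ IsEmpty H →
    (r s : ℕ) → 1 ≤ s → s ≤ r →
    -- (1)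
    (∀ k (a : Fin k → Carrier) → (∀ t → a t ∈ H ^[ p ^ r ]) →
        (LinIndepMod p (H ⊕ p G) a → LinIndepMod (p ^ r) (H ⊕ p ^ r G) a)
      × (LinIndepMod (p ^ r) (H ⊕ p ^ r G) a →
           (∀ (m : Fin k → ℤ) → (∃ λ t → VpLessThan p (m t) r) → 𝔰[ p ^ r ] linComb m a ≐ H))
      × ((∀ (m : Fin k → ℤ) → (∃ λ t → VpLessThan p (m t) r) → 𝔰[ p ^ r ] linComb m a ≐ H) →
           LinIndepMod p (H ⊕ p G) a))
    -- (2)
    × (∀ (I : Set c) →
        (Σ (I → Carrier) λ f → (∀ i → f i ∈ (H ^[ p ^ r ]) ⊕ p G) × FamIndepMod p (H ⊕ p G) f)
        ⇔ (Σ (I → Carrier) λ f → (∀ i → f i ∈ H ^[ p ^ r ]) × FamIndepMod (p ^ r) (H ⊕ p ^ r G) f))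
    -- (3)
    × (∀ k (a : Fin k → Carrier) → (∀ t → a t ∈ H ^[ p ^ r ]) →
        LinIndepMod (p ^ r) (H ⊕ p ^ r G) a → LinIndepMod (p ^ s) (H ⊕ p ^ s G) a)
lemma2p15 _ _ _ _ (_ , inj₁ (_ , H-empty)) H≢∅ _ _ _ _ = ⊥-elim (H≢∅ H-empty)
lemma2p15 G p p-prime _ (_ , inj₂ (_ , H-convex , a₀∉H⊕pG , H-largest)) H≢∅
          (suc r) (suc s) (s≤s z≤n) (s≤s _) =
    (λ _ _ a∈H^ → indep⇒indep-pow (suc r)
                , indep-pow⇒𝔰≐ a₀∉H⊕pG H-largest (suc r) a∈H^
                , 𝔰≐⇒indep H≢∅ r)
  , (λ _ → mk⇔ (famIndep⇒famIndep-pow (suc r)) (famIndep-pow⇒famIndep r))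
  , (λ _ _ _ → indep⇒indep-pow (suc s) ∘ indep-pow⇒indep r)
  where
  open OrderedAbelianGroupProperties G
  open Independence p {{prime⇒nonZero p-prime}} H-convex
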